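{- Let $D\ge2$, let $N\in\{2D,2D+1\}$, and let $\Gamma$ be the cycle graph on $X=\{0,\dots,N-1\}$. Then no two distinct orbits of $\operatorname{Aut}(\Gamma)$ acting on $X\times X\times X$ have the same distance profile. That is, two triples lie in the same orbit if and only if they have the same distance profile.
   Context: $\Gamma$ has vertex set $X=\mathbb{Z}/N\mathbb{Z}$, with $x\sim y$ iff $x-y\equiv\pm1 \pmod N$. Its distance is $\partial(x,y)=\min\{r,N-r\}$ with $r\equiv x-y \pmod N$, $0\le r<N$, and its diameter is $D$. $\operatorname{Aut}(\Gamma)$ (the dihedral group of order $2N$) acts on triples by $g(x,y,z)=(g(x),g(y),g(z))$. The distance profile of $(x,y,z)$ is $(\partial(y,z),\partial(x,z),\partial(x,y))$. All triples in one orbit share a distance profile, which is called the distance profile of the orbit. -}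

module Defs where

open import Data.Nat using (ℕ; suc; _+_; _∸_; _⊓_; _%_; NonZero)
open import Data.Fin using (Fin; toℕ)
open import Data.Product using (_×_; _,_; Σ; ∃)
open import Data.Sum using (_⊎_)
open import Relation.Binary.PropositionalEquality using (_≡_)
open import Function.Bundles using (_↔_; Inverse)

Adj : (N : ℕ) .{{_ : NonZero N}} → Fin N → Fin N → Set
Adj N x y = ((toℕ x + 1) % N ≡ toℕ y) ⊎ ((toℕ y + 1) % N ≡ toℕ x)

dist : (N : ℕ) .{{_ : NonZero N}} → Fin N → Fin N → ℕ
dist N x y = r ⊓ (N ∸ r)
  where r = (toℕ x + (N ∸ toℕ y)) % N

record Aut (N : ℕ) .{{_ : NonZero N}} : Set where
  field
    perm : Fin N ↔ Fin N
    preserves : ∀ x y → Adj N x y → Adj N (Inverse.to perm x) (Inverse.to perm y)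
    reflects  : ∀ x y → Adj N (Inverse.to perm x) (Inverse.to perm y) → Adj N x y

Triple : ℕ → Set
Triple N = Fin N × Fin N × Fin N

act : (N : ℕ) .{{_ : NonZero N}} → Aut N → Triple N → Triple N
act N g (x , y , z) = f x , f y , f z
  where f = Inverse.to (Aut.perm g)

SameOrbit : (N : ℕ) .{{_ : NonZero N}} → Triple N → Triple N → Set
SameOrbit N t t' = Σ (Aut N) (λ g → act N g t ≡ t')

profile : (N : ℕ) .{{_ : NonZero N}} → Triple N → ℕ × ℕ × ℕ
profile N (x , y , z) = dist N y z , dist N x z , dist N x y

{-# OPTIONS --safe #-}
module Submission where

open import Data.Nat
open import Data.Nat.Properties
open import Data.Nat.DivMod
open import Data.Fin using (Fin; toℕ)
open import Data.Fin.Properties using (toℕ-fromℕ<; toℕ<n; toℕ-injective)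
open import Data.Product using (_×_; _,_; ∃-syntax; proj₁; proj₂)
open import Data.Sum using (_⊎_; inj₁; inj₂; fromInj₂)
open import Data.Empty using (⊥-elim)
open import Function.Base using (_∘_)
open import Function.Bundles using (Inverse; mk↔ₛ′)
open import Function.Construct.Composition using (_↔-∘_)
open import Function.Construct.Identity using (↔-id)
open import Function.Construct.Symmetry using (↔-sym)
open import Relation.Binary.Definitions using (tri<; tri≈; tri>)
open import Relation.Binary.PropositionalEquality
open import Relation.Nullary using (¬_; Dec; yes; no)
open import Relation.Nullary.Decidable using (_×-dec_)
open import Algebra.Properties.CommutativeSemigroup +-commutativeSemigroup using (xy∙z≈xz∙y)
open import Defs

-- Automorphisms preserve the graph metric, and ∂ is that metric: ∂(x,y) ≤ k iff a walk of
-- length at most k joins x and y, since ∂ is 1-Lipschitz along edges and both arcs of the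
-- cycle between x and y are walks. So the profile is an orbit invariant. Conversely, a
-- rotation and at most two reflections bring every triple to a normal form (0, b, c) with
-- b ≤ N/2, and c ≤ N/2 unless 0 < b < N/2. The profile pins this normal form down: it gives
-- b = ∂(0,b), and c is ∂(0,c) or N − ∂(0,c); when both choices are allowed, ∂(b,c) = |b − c|
-- is smaller than min(b + c, N − b − c), its value for the other choice.

⊓-mono-≤-suc : ∀ {m n o p} → m ≤ suc o → n ≤ suc p → m ⊓ n ≤ suc (o ⊓ p)
⊓-mono-≤-suc {m} {n} {o} {p} m≤1+o n≤1+p =
  subst (m ⊓ n ≤_) (sym (+-distribˡ-⊓ 1 o p)) (⊓-mono-≤ m≤1+o n≤1+p)

∣m-n∣<m+n : ∀ {m n} → 0 < m → 0 < n → ∣ m - n ∣ < m + n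
∣m-n∣<m+n {suc m} {suc n} _ _ =
  s≤s (≤-trans (∣m-n∣≤m⊔n m n) (≤-trans (m⊔n≤m+n m n) (+-monoʳ-≤ m (n≤1+n n))))

m≤n⇒∣m-n∣+[m+n]≡n+n : ∀ {m n} → m ≤ n → ∣ m - n ∣ + (m + n) ≡ n + n
m≤n⇒∣m-n∣+[m+n]≡n+n {m} {n} m≤n = begin
  ∣ m - n ∣ + (m + n)  ≡⟨ cong (_+ (m + n)) (m≤n⇒∣m-n∣≡n∸m m≤n) ⟩
  n ∸ m + (m + n)      ≡⟨ +-assoc (n ∸ m) m n ⟨
  n ∸ m + m + n        ≡⟨ cong (_+ n) (m∸n+n≡m m≤n) ⟩
  n + n                ∎
  where open ≡-Reasoning

∣m-n∣+[m+n]≡[m⊔n]+[m⊔n] : ∀ m n → ∣ m - n ∣ + (m + n) ≡ (m ⊔ n) + (m ⊔ n)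
∣m-n∣+[m+n]≡[m⊔n]+[m⊔n] m n with ≤-total m n
... | inj₁ m≤n = trans (m≤n⇒∣m-n∣+[m+n]≡n+n m≤n) (cong (λ k → k + k) (sym (m≤n⇒m⊔n≡n m≤n)))
... | inj₂ n≤m = begin
  ∣ m - n ∣ + (m + n)  ≡⟨ cong₂ _+_ (∣-∣-comm m n) (+-comm m n) ⟩
  ∣ n - m ∣ + (n + m)  ≡⟨ m≤n⇒∣m-n∣+[m+n]≡n+n n≤m ⟩
  m + m                ≡⟨ cong (λ k → k + k) (m≥n⇒m⊔n≡m n≤m) ⟨
  (m ⊔ n) + (m ⊔ n)    ∎
  where open ≡-Reasoning

[m%d+n]%d≡[m+n]%d : ∀ m n d .{{_ : NonZero d}} → (m % d + n) % d ≡ (m + n) % d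
[m%d+n]%d≡[m+n]%d m n d = begin
  (m % d + n) % d          ≡⟨ %-distribˡ-+ (m % d) n d ⟩
  (m % d % d + n % d) % d  ≡⟨ cong (λ k → (k + n % d) % d) (m%n%n≡m%n m d) ⟩
  (m % d + n % d) % d      ≡⟨ %-distribˡ-+ m n d ⟨
  (m + n) % d              ∎
  where open ≡-Reasoning

module Cycle (N : ℕ) .{{_ : NonZero N}} where

  arc : ℕ → ℕ
  arc e = e ⊓ (N ∸ e)

  Half : ℕ → Set
  Half e = e ≤ N ∸ e

  Half? : ∀ e → Dec (Half e)
  Half? e = e ≤? N ∸ e

  OpenHalf : ℕ → Set
  OpenHalf e = 0 < e × e < N ∸ e

  OpenHalf? : ∀ e → Dec (OpenHalf e)
  OpenHalf? e = (0 <? e) ×-dec (e <? N ∸ e)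

  arc-Half : ∀ {e} → Half e → arc e ≡ e
  arc-Half = m≤n⇒m⊓n≡m

  arc-reflect : ∀ {e} → e ≤ N → arc (N ∸ e) ≡ arc e
  arc-reflect {e} e≤N = trans (cong ((N ∸ e) ⊓_) (m∸[m∸n]≡n e≤N)) (⊓-comm (N ∸ e) e)

  arc-fibre : ∀ {e e'} → e ≤ N → e' ≤ N → arc e ≡ arc e' → e ≡ e' ⊎ e + e' ≡ N
  arc-fibre {e} {e'} e≤N e'≤N eq with ⊓-sel e (N ∸ e) | ⊓-sel e' (N ∸ e')
  ... | inj₁ p | inj₁ q = inj₁ (trans (sym p) (trans eq q))
  ... | inj₁ p | inj₂ q = inj₂ (trans (cong (_+ e') (trans (sym p) (trans eq q))) (m∸n+n≡m e'≤N))
  ... | inj₂ p | inj₁ q = inj₂ (trans (cong (e +_) (trans (sym q) (trans (sym eq) p))) (m+[n∸m]≡n e≤N))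
  ... | inj₂ p | inj₂ q = inj₁ (∸-cancelˡ-≡ e≤N e'≤N (trans (sym p) (trans eq q)))

  [r+1]%N-cases : ∀ {r} → r < N →
                  (suc r < N × (r + 1) % N ≡ suc r) ⊎ (suc r ≡ N × (r + 1) % N ≡ 0)
  [r+1]%N-cases {r} r<N with m≤n⇒m<n∨m≡n r<N
  ... | inj₁ 1+r<N = inj₁ (1+r<N , trans (cong (_% N) (+-comm r 1)) (m<n⇒m%n≡m 1+r<N))
  ... | inj₂ 1+r≡N = inj₂ (1+r≡N , trans (cong (_% N) (trans (+-comm r 1) 1+r≡N)) (n%n≡0 N))

  arc-step : ∀ {r} → r < N → arc r ≤ suc (arc ((r + 1) % N)) × arc ((r + 1) % N) ≤ suc (arc r)
  arc-step {r} r<N with [r+1]%N-cases r<N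
  ... | inj₁ (1+r<N , eq) rewrite eq =
    ⊓-mono-≤-suc (≤-trans (n≤1+n r) (n≤1+n (suc r))) (≤-reflexive N∸r≡1+N∸[1+r]) ,
    ⊓-mono-≤-suc ≤-refl (≤-trans (∸-monoʳ-≤ N (n≤1+n r)) (n≤1+n (N ∸ r)))
    where
    N∸r≡1+N∸[1+r] : N ∸ r ≡ suc (N ∸ suc r)
    N∸r≡1+N∸[1+r] = +-∸-assoc 1 (<⇒≤ 1+r<N)
  ... | inj₂ (1+r≡N , eq) rewrite eq =
    ≤-trans (m⊓n≤n r (N ∸ r)) (≤-reflexive N∸r≡1) , z≤n
    where
    N∸r≡1 : N ∸ r ≡ 1
    N∸r≡1 = trans (cong (_∸ r) (sym 1+r≡N)) (m+n∸n≡m 1 r)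

  arc-separates : ∀ {m n} → OpenHalf m → OpenHalf n → arc ∣ m - n ∣ < arc ∣ m - (N ∸ n) ∣
  arc-separates {m} {n} (0<m , m<N∸m) (0<n , n<N∸n) = begin-strict
    arc ∣ m - n ∣            ≤⟨ m⊓n≤m _ _ ⟩
    ∣ m - n ∣                <⟨ ⊓-glb (∣m-n∣<m+n 0<m 0<n) (m+n≤o⇒m≤o∸n (suc ∣ m - n ∣) sum<N) ⟩
    arc (m + n)              ≡⟨ arc-reflect m+n≤N ⟨
    arc (N ∸ (m + n))        ≡⟨ cong arc mirror ⟨
    arc ∣ m - (N ∸ n) ∣      ∎
    where
    open ≤-Reasoning
    double< : ∀ {e} → e < N ∸ e → e + e < N
    double< {e} e<N∸e = m≤o∸n⇒m+n≤o (suc e) (≤-trans (<⇒≤ e<N∸e) (m∸n≤m N e)) e<N∸e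
    max-open : m ⊔ n < N ∸ (m ⊔ n)
    max-open with ⊔-sel m n
    ... | inj₁ m⊔n≡m = subst (λ k → k < N ∸ k) (sym m⊔n≡m) m<N∸m
    ... | inj₂ m⊔n≡n = subst (λ k → k < N ∸ k) (sym m⊔n≡n) n<N∸n
    sum<N : ∣ m - n ∣ + (m + n) < N
    sum<N = subst (_< N) (sym (∣m-n∣+[m+n]≡[m⊔n]+[m⊔n] m n)) (double< max-open)
    m+n≤N : m + n ≤ N
    m+n≤N = <⇒≤ (≤-<-trans (m≤n+m (m + n) ∣ m - n ∣) sum<N)
    mirror : ∣ m - (N ∸ n) ∣ ≡ N ∸ (m + n)
    mirror = begin-equality
      ∣ m - (N ∸ n) ∣  ≡⟨ m≤n⇒∣m-n∣≡n∸m (m+n≤o⇒m≤o∸n m m+n≤N) ⟩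
      N ∸ n ∸ m        ≡⟨ ∸-+-assoc N n m ⟩
      N ∸ (n + m)      ≡⟨ cong (N ∸_) (+-comm n m) ⟩
      N ∸ (m + n)      ∎

  infixl 6 _⊕_
  _⊕_ : Fin N → ℕ → Fin N
  x ⊕ d = (toℕ x + d) mod N

  toℕ-⊕ : ∀ x d → toℕ (x ⊕ d) ≡ (toℕ x + d) % N
  toℕ-⊕ x d = toℕ-fromℕ< (m%n<n (toℕ x + d) N)

  ⊕-assoc : ∀ x a b → x ⊕ a ⊕ b ≡ x ⊕ (a + b)
  ⊕-assoc x a b = toℕ-injective (begin
    toℕ (x ⊕ a ⊕ b)            ≡⟨ toℕ-⊕ (x ⊕ a) b ⟩
    (toℕ (x ⊕ a) + b) % N      ≡⟨ cong (λ k → (k + b) % N) (toℕ-⊕ x a) ⟩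
    ((toℕ x + a) % N + b) % N  ≡⟨ [m%d+n]%d≡[m+n]%d (toℕ x + a) b N ⟩
    (toℕ x + a + b) % N        ≡⟨ cong (_% N) (+-assoc (toℕ x) a b) ⟩
    (toℕ x + (a + b)) % N      ≡⟨ toℕ-⊕ x (a + b) ⟨
    toℕ (x ⊕ (a + b))          ∎)
    where open ≡-Reasoning

  ⊕-swap : ∀ x a b → x ⊕ a ⊕ b ≡ x ⊕ b ⊕ a
  ⊕-swap x a b = trans (⊕-assoc x a b) (trans (cong (x ⊕_) (+-comm a b)) (sym (⊕-assoc x b a)))

  ⊕-identityʳ : ∀ x → x ⊕ 0 ≡ x
  ⊕-identityʳ x = toℕ-injective
    (trans (toℕ-⊕ x 0) (trans (cong (_% N) (+-identityʳ (toℕ x))) (m<n⇒m%n≡m (toℕ<n x))))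

  ⊕-N : ∀ x → x ⊕ N ≡ x
  ⊕-N x = toℕ-injective
    (trans (toℕ-⊕ x N) (trans ([m+n]%n≡m%n (toℕ x) N) (m<n⇒m%n≡m (toℕ<n x))))

  ⊕-cancel : ∀ x {d} → d ≤ N → x ⊕ d ⊕ (N ∸ d) ≡ x
  ⊕-cancel x {d} d≤N = trans (⊕-assoc x d (N ∸ d)) (trans (cong (x ⊕_) (m+[n∸m]≡n d≤N)) (⊕-N x))

  Adj-⊕1 : ∀ x → Adj N x (x ⊕ 1)
  Adj-⊕1 x = inj₁ (sym (toℕ-⊕ x 1))

  ⊕1-Adj : ∀ x → Adj N (x ⊕ 1) x
  ⊕1-Adj x = inj₂ (sym (toℕ-⊕ x 1))

  Adj⇒⊕1 : ∀ {x y} → Adj N x y → x ⊕ 1 ≡ y ⊎ y ⊕ 1 ≡ x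
  Adj⇒⊕1 {x} (inj₁ eq) = inj₁ (toℕ-injective (trans (toℕ-⊕ x 1) eq))
  Adj⇒⊕1 {y = y} (inj₂ eq) = inj₂ (toℕ-injective (trans (toℕ-⊕ y 1) eq))

  Walk≤ : ℕ → Fin N → Fin N → Set
  Walk≤ zero    x y = x ≡ y
  Walk≤ (suc k) x y = Walk≤ k x y ⊎ ∃[ z ] Adj N x z × Walk≤ k z y

  Walk≤-mono : ∀ {j k x y} → j ≤ k → Walk≤ j x y → Walk≤ k x y
  Walk≤-mono {zero}  {zero}  z≤n       w                  = w
  Walk≤-mono {zero}  {suc k} z≤n       w                  = inj₁ (Walk≤-mono {zero} {k} z≤n w)
  Walk≤-mono {suc j} {suc k} (s≤s j≤k) (inj₁ w)           = inj₁ (Walk≤-mono j≤k w)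
  Walk≤-mono {suc j} {suc k} (s≤s j≤k) (inj₂ (z , a , w)) = inj₂ (z , a , Walk≤-mono j≤k w)

  walk-forward : ∀ j x → Walk≤ j x (x ⊕ j)
  walk-forward zero    x = sym (⊕-identityʳ x)
  walk-forward (suc j) x =
    inj₂ (x ⊕ 1 , Adj-⊕1 x , subst (Walk≤ j (x ⊕ 1)) (⊕-assoc x 1 j) (walk-forward j (x ⊕ 1)))

  walk-backward : ∀ j x → Walk≤ j (x ⊕ j) x
  walk-backward zero    x = ⊕-identityʳ x
  walk-backward (suc j) x =
    inj₂ (x ⊕ j , subst (λ u → Adj N u (x ⊕ j)) ⊕j⊕1≡⊕[1+j] (⊕1-Adj (x ⊕ j)) , walk-backward j x)
    where
    ⊕j⊕1≡⊕[1+j] : x ⊕ j ⊕ 1 ≡ x ⊕ suc j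
    ⊕j⊕1≡⊕[1+j] = trans (⊕-swap x j 1) (⊕-assoc x 1 j)

  residue : Fin N → Fin N → ℕ
  residue x y = (toℕ x + (N ∸ toℕ y)) % N

  residue<N : ∀ x y → residue x y < N
  residue<N x y = m%n<n _ N

  residue-self : ∀ x → residue x x ≡ 0
  residue-self x = trans (cong (_% N) (m+[n∸m]≡n (<⇒≤ (toℕ<n x)))) (n%n≡0 N)

  ⊕-residue : ∀ x y → y ⊕ residue x y ≡ x
  ⊕-residue x y = toℕ-injective (begin
    toℕ (y ⊕ residue x y)                   ≡⟨ toℕ-⊕ y (residue x y) ⟩
    (toℕ y + residue x y) % N               ≡⟨ cong (_% N) (+-comm (toℕ y) (residue x y)) ⟩
    (residue x y + toℕ y) % N               ≡⟨ [m%d+n]%d≡[m+n]%d (toℕ x + (N ∸ toℕ y)) (toℕ y) N ⟩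
    (toℕ x + (N ∸ toℕ y) + toℕ y) % N       ≡⟨ cong (_% N) (+-assoc (toℕ x) (N ∸ toℕ y) (toℕ y)) ⟩
    (toℕ x + (N ∸ toℕ y + toℕ y)) % N       ≡⟨ cong (λ k → (toℕ x + k) % N) (m∸n+n≡m (<⇒≤ (toℕ<n y))) ⟩
    (toℕ x + N) % N                         ≡⟨ [m+n]%n≡m%n (toℕ x) N ⟩
    toℕ x % N                               ≡⟨ m<n⇒m%n≡m (toℕ<n x) ⟩
    toℕ x                                   ∎)
    where open ≡-Reasoning

  residue-⊕1 : ∀ x y → residue (x ⊕ 1) y ≡ (residue x y + 1) % N
  residue-⊕1 x y = begin
    (toℕ (x ⊕ 1) + (N ∸ toℕ y)) % N         ≡⟨ cong (λ k → (k + (N ∸ toℕ y)) % N) (toℕ-⊕ x 1) ⟩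
    ((toℕ x + 1) % N + (N ∸ toℕ y)) % N     ≡⟨ [m%d+n]%d≡[m+n]%d (toℕ x + 1) (N ∸ toℕ y) N ⟩
    (toℕ x + 1 + (N ∸ toℕ y)) % N           ≡⟨ cong (_% N) (xy∙z≈xz∙y (toℕ x) 1 (N ∸ toℕ y)) ⟩
    (toℕ x + (N ∸ toℕ y) + 1) % N           ≡⟨ [m%d+n]%d≡[m+n]%d (toℕ x + (N ∸ toℕ y)) 1 N ⟨
    (residue x y + 1) % N                   ∎
    where open ≡-Reasoning

  both-arcs-walkable : ∀ x y → Walk≤ (residue x y) x y × Walk≤ (N ∸ residue x y) x y
  both-arcs-walkable x y =
    subst (λ u → Walk≤ r u y) (⊕-residue x y) (walk-backward r y) ,
    subst (Walk≤ (N ∸ r) x) x⊕[N∸r]≡y (walk-forward (N ∸ r) x)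
    where
    r = residue x y
    x⊕[N∸r]≡y : x ⊕ (N ∸ r) ≡ y
    x⊕[N∸r]≡y = trans (cong (_⊕ (N ∸ r)) (sym (⊕-residue x y))) (⊕-cancel y (<⇒≤ (residue<N x y)))

  dist-⊕1 : ∀ x y → dist N x y ≤ suc (dist N (x ⊕ 1) y) × dist N (x ⊕ 1) y ≤ suc (dist N x y)
  dist-⊕1 x y = subst (λ r → arc (residue x y) ≤ suc (arc r) × arc r ≤ suc (arc (residue x y)))
                      (sym (residue-⊕1 x y)) (arc-step (residue<N x y))

  dist-Adj : ∀ {x z} y → Adj N x z → dist N x y ≤ suc (dist N z y)
  dist-Adj {x} {z} y x∼z with Adj⇒⊕1 x∼z
  ... | inj₁ refl = proj₁ (dist-⊕1 x y)
  ... | inj₂ refl = proj₂ (dist-⊕1 z y)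

  walk⇒dist≤ : ∀ k {x y} → Walk≤ k x y → dist N x y ≤ k
  walk⇒dist≤ zero    {x} refl                 = ≤-reflexive (cong arc (residue-self x))
  walk⇒dist≤ (suc k) (inj₁ w)                 = m≤n⇒m≤1+n (walk⇒dist≤ k w)
  walk⇒dist≤ (suc k) {y = y} (inj₂ (z , x∼z , w)) = ≤-trans (dist-Adj y x∼z) (s≤s (walk⇒dist≤ k w))

  dist≤⇒walk : ∀ k {x y} → dist N x y ≤ k → Walk≤ k x y
  dist≤⇒walk k {x} {y} d≤k with ⊓-sel (residue x y) (N ∸ residue x y)
  ... | inj₁ d≡r   = Walk≤-mono (subst (_≤ k) d≡r d≤k) (proj₁ (both-arcs-walkable x y))
  ... | inj₂ d≡N∸r = Walk≤-mono (subst (_≤ k) d≡N∸r d≤k) (proj₂ (both-arcs-walkable x y))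

  ⟦_⟧ : Aut N → Fin N → Fin N
  ⟦ g ⟧ = Inverse.to (Aut.perm g)

  ⟦_⟧⁻¹ : Aut N → Fin N → Fin N
  ⟦ g ⟧⁻¹ = Inverse.from (Aut.perm g)

  mkAut : (f f⁻¹ : Fin N → Fin N) → (∀ y → f (f⁻¹ y) ≡ y) → (∀ x → f⁻¹ (f x) ≡ x) →
          (∀ {x y} → Adj N x y → Adj N (f x) (f y)) → (∀ {x y} → Adj N x y → Adj N (f⁻¹ x) (f⁻¹ y)) →
          Aut N
  mkAut f f⁻¹ f∘f⁻¹ f⁻¹∘f f-Adj f⁻¹-Adj = record
    { perm      = mk↔ₛ′ f f⁻¹ f∘f⁻¹ f⁻¹∘f
    ; preserves = λ _ _ → f-Adj
    ; reflects  = λ x y fx∼fy → subst₂ (Adj N) (f⁻¹∘f x) (f⁻¹∘f y) (f⁻¹-Adj fx∼fy)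
    }

  Aut-id : Aut N
  Aut-id = record
    { perm      = ↔-id (Fin N)
    ; preserves = λ _ _ x∼y → x∼y
    ; reflects  = λ _ _ x∼y → x∼y
    }

  Aut-∘ : Aut N → Aut N → Aut N
  Aut-∘ h g = record
    { perm      = Aut.perm h ↔-∘ Aut.perm g
    ; preserves = λ x y x∼y → Aut.preserves h _ _ (Aut.preserves g x y x∼y)
    ; reflects  = λ x y hgx∼hgy → Aut.reflects g x y (Aut.reflects h _ _ hgx∼hgy)
    }

  Aut-inverse : Aut N → Aut N
  Aut-inverse g = record
    { perm      = ↔-sym perm
    ; preserves = λ x y x∼y → reflects (from x) (from y)
                    (subst₂ (Adj N) (sym (strictlyInverseˡ x)) (sym (strictlyInverseˡ y)) x∼y)
    ; reflects  = λ x y gx∼gy → subst₂ (Adj N) (strictlyInverseˡ x) (strictlyInverseˡ y)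
                    (preserves (from x) (from y) gx∼gy)
    }
    where
    open Aut g
    open Inverse perm

  ⟦⟧⁻¹∘⟦⟧ : ∀ g x → ⟦ g ⟧⁻¹ (⟦ g ⟧ x) ≡ x
  ⟦⟧⁻¹∘⟦⟧ g = Inverse.strictlyInverseʳ (Aut.perm g)

  walk-map : ∀ g k {x y} → Walk≤ k x y → Walk≤ k (⟦ g ⟧ x) (⟦ g ⟧ y)
  walk-map g zero    refl               = refl
  walk-map g (suc k) (inj₁ w)           = inj₁ (walk-map g k w)
  walk-map g (suc k) (inj₂ (z , x∼z , w)) = inj₂ (⟦ g ⟧ z , Aut.preserves g _ z x∼z , walk-map g k w)

  dist-map-≤ : ∀ g x y → dist N (⟦ g ⟧ x) (⟦ g ⟧ y) ≤ dist N x y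
  dist-map-≤ g x y = walk⇒dist≤ _ (walk-map g _ (dist≤⇒walk _ ≤-refl))

  dist-map : ∀ g x y → dist N (⟦ g ⟧ x) (⟦ g ⟧ y) ≡ dist N x y
  dist-map g x y = ≤-antisym (dist-map-≤ g x y)
    (subst₂ (λ u v → dist N u v ≤ dist N (⟦ g ⟧ x) (⟦ g ⟧ y)) (⟦⟧⁻¹∘⟦⟧ g x) (⟦⟧⁻¹∘⟦⟧ g y)
            (dist-map-≤ (Aut-inverse g) (⟦ g ⟧ x) (⟦ g ⟧ y)))

  profile-act : ∀ g t → profile N (act N g t) ≡ profile N t
  profile-act g (x , y , z) = cong₂ _,_ (dist-map g y z) (cong₂ _,_ (dist-map g x z) (dist-map g x y))

  orbit-sym : ∀ {t t'} → SameOrbit N t t' → SameOrbit N t' t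
  orbit-sym {x , y , z} (g , refl) =
    Aut-inverse g , cong₂ _,_ (⟦⟧⁻¹∘⟦⟧ g x) (cong₂ _,_ (⟦⟧⁻¹∘⟦⟧ g y) (⟦⟧⁻¹∘⟦⟧ g z))

  orbit-trans : ∀ {t t' t''} → SameOrbit N t t' → SameOrbit N t' t'' → SameOrbit N t t''
  orbit-trans (g , refl) (h , refl) = Aut-∘ h g , refl

  sameOrbit⇒≡profile : ∀ {t t'} → SameOrbit N t t' → profile N t ≡ profile N t'
  sameOrbit⇒≡profile {t} (g , refl) = sym (profile-act g t)

  ⊕-Adj : ∀ a {x y} → Adj N x y → Adj N (x ⊕ a) (y ⊕ a)
  ⊕-Adj a {x} {y} x∼y with Adj⇒⊕1 x∼y
  ... | inj₁ refl = subst (Adj N (x ⊕ a)) (⊕-swap x a 1) (Adj-⊕1 (x ⊕ a))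
  ... | inj₂ refl = subst (λ u → Adj N u (y ⊕ a)) (⊕-swap y a 1) (⊕1-Adj (y ⊕ a))

  rotation : ∀ d → d ≤ N → Aut N
  rotation d d≤N = mkAut (_⊕ d) (_⊕ (N ∸ d)) ⊕[N∸d]⊕d (λ x → ⊕-cancel x d≤N) (⊕-Adj d) (⊕-Adj (N ∸ d))
    where
    ⊕[N∸d]⊕d : ∀ y → y ⊕ (N ∸ d) ⊕ d ≡ y
    ⊕[N∸d]⊕d y = subst (λ e → y ⊕ (N ∸ d) ⊕ e ≡ y) (m∸[m∸n]≡n d≤N) (⊕-cancel y (m∸n≤m N d))

  neg : Fin N → Fin N
  neg x = (N ∸ toℕ x) mod N

  toℕ-neg : ∀ x → toℕ (neg x) ≡ (N ∸ toℕ x) % N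
  toℕ-neg x = toℕ-fromℕ< (m%n<n (N ∸ toℕ x) N)

  neg-zero : ∀ {x} → toℕ x ≡ 0 → toℕ (neg x) ≡ 0
  neg-zero {x} x≡0 = trans (toℕ-neg x) (trans (cong (λ k → (N ∸ k) % N) x≡0) (n%n≡0 N))

  neg-pos : ∀ {x} → 0 < toℕ x → toℕ (neg x) ≡ N ∸ toℕ x
  neg-pos {x} 0<x = trans (toℕ-neg x) (m<n⇒m%n≡m (∸-monoʳ-< 0<x (<⇒≤ (toℕ<n x))))

  neg-involutive : ∀ x → neg (neg x) ≡ x
  neg-involutive x with m≤n⇒m<n∨m≡n (z≤n {toℕ x})
  ... | inj₂ 0≡x = toℕ-injective (trans (neg-zero (neg-zero (sym 0≡x))) 0≡x)
  ... | inj₁ 0<x = toℕ-injective (begin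
    toℕ (neg (neg x))      ≡⟨ neg-pos (subst (0 <_) (sym (neg-pos 0<x)) (m<n⇒0<n∸m (toℕ<n x))) ⟩
    N ∸ toℕ (neg x)        ≡⟨ cong (N ∸_) (neg-pos 0<x) ⟩
    N ∸ (N ∸ toℕ x)        ≡⟨ m∸[m∸n]≡n (<⇒≤ (toℕ<n x)) ⟩
    toℕ x                  ∎)
    where open ≡-Reasoning

  [N∸[r+1]%N+1]%N≡[N∸r]%N : ∀ {r} → r < N → (N ∸ (r + 1) % N + 1) % N ≡ (N ∸ r) % N
  [N∸[r+1]%N+1]%N≡[N∸r]%N {r} r<N with [r+1]%N-cases r<N
  ... | inj₁ (1+r<N , eq) rewrite eq =
    cong (_% N) (trans (+-comm (N ∸ suc r) 1) (sym (+-∸-assoc 1 (<⇒≤ 1+r<N))))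
  ... | inj₂ (1+r≡N , eq) rewrite eq = begin
    (N + 1) % N  ≡⟨ cong (_% N) (+-comm N 1) ⟩
    (1 + N) % N  ≡⟨ [m+n]%n≡m%n 1 N ⟩
    1 % N        ≡⟨ cong (_% N) (trans (cong (_∸ r) (sym 1+r≡N)) (m+n∸n≡m 1 r)) ⟨
    (N ∸ r) % N  ∎
    where open ≡-Reasoning

  neg-⊕1 : ∀ x → neg (x ⊕ 1) ⊕ 1 ≡ neg x
  neg-⊕1 x = toℕ-injective (begin
    toℕ (neg (x ⊕ 1) ⊕ 1)              ≡⟨ toℕ-⊕ (neg (x ⊕ 1)) 1 ⟩
    (toℕ (neg (x ⊕ 1)) + 1) % N        ≡⟨ cong (λ k → (k + 1) % N) (toℕ-neg (x ⊕ 1)) ⟩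
    ((N ∸ toℕ (x ⊕ 1)) % N + 1) % N    ≡⟨ [m%d+n]%d≡[m+n]%d (N ∸ toℕ (x ⊕ 1)) 1 N ⟩
    (N ∸ toℕ (x ⊕ 1) + 1) % N          ≡⟨ cong (λ k → (N ∸ k + 1) % N) (toℕ-⊕ x 1) ⟩
    (N ∸ (toℕ x + 1) % N + 1) % N      ≡⟨ [N∸[r+1]%N+1]%N≡[N∸r]%N (toℕ<n x) ⟩
    (N ∸ toℕ x) % N                    ≡⟨ toℕ-neg x ⟨
    toℕ (neg x)                        ∎)
    where open ≡-Reasoning

  neg-Adj : ∀ {x y} → Adj N x y → Adj N (neg x) (neg y)
  neg-Adj {x} {y} x∼y with Adj⇒⊕1 x∼y
  ... | inj₁ refl = subst (λ u → Adj N u (neg (x ⊕ 1))) (neg-⊕1 x) (⊕1-Adj (neg (x ⊕ 1)))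
  ... | inj₂ refl = subst (Adj N (neg (y ⊕ 1))) (neg-⊕1 y) (Adj-⊕1 (neg (y ⊕ 1)))

  reflection : Aut N
  reflection = mkAut neg neg neg-involutive neg-involutive neg-Adj neg-Adj

  [m+[N∸n]]%N≡m∸n : ∀ {m n} → n ≤ m → m < N → (m + (N ∸ n)) % N ≡ m ∸ n
  [m+[N∸n]]%N≡m∸n {m} {n} n≤m m<N = begin
    (m + (N ∸ n)) % N  ≡⟨ cong (_% N) (+-∸-assoc m (≤-trans n≤m (<⇒≤ m<N))) ⟨
    (m + N ∸ n) % N    ≡⟨ cong (_% N) (+-∸-comm N n≤m) ⟩
    (m ∸ n + N) % N    ≡⟨ [m+n]%n≡m%n (m ∸ n) N ⟩
    (m ∸ n) % N        ≡⟨ m<n⇒m%n≡m (≤-<-trans (m∸n≤m m n) m<N) ⟩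
    m ∸ n              ∎
    where open ≡-Reasoning

  [m+[N∸n]]%N≡N∸[n∸m] : ∀ {m n} → m < n → n < N → (m + (N ∸ n)) % N ≡ N ∸ (n ∸ m)
  [m+[N∸n]]%N≡N∸[n∸m] {m} {n} m<n n<N = trans (cong (_% N) m+[N∸n]≡N∸[n∸m]) (m<n⇒m%n≡m N∸[n∸m]<N)
    where
    open ≡-Reasoning
    m+[N∸n]≡N∸[n∸m] : m + (N ∸ n) ≡ N ∸ (n ∸ m)
    m+[N∸n]≡N∸[n∸m] = begin
      m + (N ∸ n)                        ≡⟨ m+n∸n≡m (m + (N ∸ n)) (n ∸ m) ⟨
      m + (N ∸ n) + (n ∸ m) ∸ (n ∸ m)    ≡⟨ cong (_∸ (n ∸ m)) (xy∙z≈xz∙y m (N ∸ n) (n ∸ m)) ⟩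
      m + (n ∸ m) + (N ∸ n) ∸ (n ∸ m)    ≡⟨ cong (λ k → k + (N ∸ n) ∸ (n ∸ m)) (m+[n∸m]≡n (<⇒≤ m<n)) ⟩
      n + (N ∸ n) ∸ (n ∸ m)              ≡⟨ cong (_∸ (n ∸ m)) (m+[n∸m]≡n (<⇒≤ n<N)) ⟩
      N ∸ (n ∸ m)                        ∎
    N∸[n∸m]<N : N ∸ (n ∸ m) < N
    N∸[n∸m]<N = ∸-monoʳ-< (m<n⇒0<n∸m m<n) (≤-trans (m∸n≤m n m) (<⇒≤ n<N))

  dist≡arc∣-∣ : ∀ x y → dist N x y ≡ arc ∣ toℕ x - toℕ y ∣
  dist≡arc∣-∣ x y with toℕ y ≤? toℕ x
  ... | yes y≤x = cong arc (trans ([m+[N∸n]]%N≡m∸n y≤x (toℕ<n x)) (sym (m≤n⇒∣n-m∣≡n∸m y≤x)))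
  ... | no  y≰x = begin
    arc (residue x y)                ≡⟨ cong arc ([m+[N∸n]]%N≡N∸[n∸m] x<y (toℕ<n y)) ⟩
    arc (N ∸ (toℕ y ∸ toℕ x))        ≡⟨ arc-reflect (≤-trans (m∸n≤m (toℕ y) (toℕ x)) (<⇒≤ (toℕ<n y))) ⟩
    arc (toℕ y ∸ toℕ x)              ≡⟨ cong arc (m≤n⇒∣m-n∣≡n∸m (<⇒≤ x<y)) ⟨
    arc ∣ toℕ x - toℕ y ∣            ∎
    where
    open ≡-Reasoning
    x<y = ≰⇒> y≰x

  dist-from-0 : ∀ {a} v → toℕ a ≡ 0 → dist N a v ≡ arc (toℕ v)
  dist-from-0 {a} v a≡0 = trans (dist≡arc∣-∣ a v) (cong (λ k → arc ∣ k - toℕ v ∣) a≡0)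

  Based : Triple N → Set
  Based (a , _ , _) = toℕ a ≡ 0

  HalfBased : Triple N → Set
  HalfBased (a , b , _) = toℕ a ≡ 0 × Half (toℕ b)

  Normal : Triple N → Set
  Normal (a , b , c) = toℕ a ≡ 0 × Half (toℕ b) × (Half (toℕ c) ⊎ OpenHalf (toℕ b))

  OrbitHas : (Triple N → Set) → Triple N → Set
  OrbitHas P t = ∃[ s ] SameOrbit N t s × P s

  OrbitHas-bind : ∀ {P Q t} → OrbitHas P t → (∀ s → P s → OrbitHas Q s) → OrbitHas Q t
  OrbitHas-bind (s , t~s , Ps) f with f s Ps
  ... | u , s~u , Qu = u , orbit-trans t~s s~u , Qu

  neg-Half : ∀ v → ¬ Half (toℕ v) → Half (toℕ (neg v))
  neg-Half v ¬half = subst Half (sym (neg-pos 0<v))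
    (subst (N ∸ toℕ v ≤_) (sym (m∸[m∸n]≡n (<⇒≤ (toℕ<n v)))) (<⇒≤ (≰⇒> ¬half)))
    where
    0<v : 0 < toℕ v
    0<v = ≤∧≢⇒< z≤n (λ 0≡v → ¬half (subst Half 0≡v z≤n))

  neg-fixes : ∀ v → Half (toℕ v) → ¬ OpenHalf (toℕ v) → toℕ (neg v) ≡ toℕ v
  neg-fixes v half ¬open with m≤n⇒m<n∨m≡n (z≤n {toℕ v})
  ... | inj₂ 0≡v = trans (neg-zero (sym 0≡v)) 0≡v
  ... | inj₁ 0<v = trans (neg-pos 0<v) (sym (≤-antisym half (≮⇒≥ (λ v<N∸v → ¬open (0<v , v<N∸v)))))

  based-orbit : ∀ t → OrbitHas Based t
  based-orbit (a , b , c) =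
    _ , (rotation (N ∸ toℕ a) (m∸n≤m N (toℕ a)) , refl) , trans (toℕ-⊕ a (N ∸ toℕ a)) (residue-self a)

  halfBased-orbit : ∀ t → Based t → OrbitHas HalfBased t
  halfBased-orbit (a , b , c) a≡0 with Half? (toℕ b)
  ... | yes half-b = _ , (Aut-id , refl) , a≡0 , half-b
  ... | no ¬half-b = _ , (reflection , refl) , neg-zero a≡0 , neg-Half b ¬half-b

  normal-orbit : ∀ t → HalfBased t → OrbitHas Normal t
  normal-orbit (a , b , c) (a≡0 , half-b) with Half? (toℕ c) | OpenHalf? (toℕ b)
  ... | yes half-c | _          = _ , (Aut-id , refl) , a≡0 , half-b , inj₁ half-c
  ... | no _       | yes open-b = _ , (Aut-id , refl) , a≡0 , half-b , inj₂ open-b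
  ... | no ¬half-c | no ¬open-b = _ , (reflection , refl) , neg-zero a≡0 ,
    subst Half (sym (neg-fixes b half-b ¬open-b)) half-b , inj₁ (neg-Half c ¬half-c)

  normal-form : ∀ t → OrbitHas Normal t
  normal-form t = OrbitHas-bind (OrbitHas-bind (based-orbit t) halfBased-orbit) normal-orbit

  mirror-separated : ∀ {b c c'} → c < c' → c + c' ≡ N → c' < N → Half c' ⊎ OpenHalf b →
                     arc ∣ b - c ∣ ≢ arc ∣ b - c' ∣
  mirror-separated {b} {c} {c'} c<c' c+c'≡N c'<N half⊎open =
    <⇒≢ (subst (λ k → arc ∣ b - c ∣ < arc ∣ b - k ∣) (sym c'≡N∸c) (arc-separates open-b open-c))
    where
    c'≡N∸c : c' ≡ N ∸ c
    c'≡N∸c = sym (trans (cong (_∸ c) (sym c+c'≡N)) (m+n∸m≡n c c'))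
    N∸c'≡c : N ∸ c' ≡ c
    N∸c'≡c = trans (cong (_∸ c') (sym c+c'≡N)) (m+n∸n≡m c c')
    open-b : OpenHalf b
    open-b = fromInj₂ (λ half → ⊥-elim (<⇒≱ c<c' (subst (c' ≤_) N∸c'≡c half))) half⊎open
    open-c : OpenHalf c
    open-c = ≤∧≢⇒< z≤n (λ 0≡c → <-irrefl (trans (cong (_+ c') 0≡c) c+c'≡N) c'<N) ,
             subst (c <_) c'≡N∸c c<c'

  third-vertex-unique : ∀ {b c c'} → c < N → c' < N → arc c ≡ arc c' →
                        Half c ⊎ OpenHalf b → Half c' ⊎ OpenHalf b →
                        arc ∣ b - c ∣ ≡ arc ∣ b - c' ∣ → c ≡ c'
  third-vertex-unique {b} {c} {c'} c<N c'<N arc-eq h h' dist-eq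
    with arc-fibre (<⇒≤ c<N) (<⇒≤ c'<N) arc-eq
  ... | inj₁ c≡c' = c≡c'
  ... | inj₂ c+c'≡N with <-cmp c c'
  ...   | tri< c<c' _ _ = ⊥-elim (mirror-separated c<c' c+c'≡N c'<N h' dist-eq)
  ...   | tri≈ _ c≡c' _ = c≡c'
  ...   | tri> _ _ c'<c = ⊥-elim (mirror-separated c'<c (trans (+-comm c' c) c+c'≡N) c<N h (sym dist-eq))

  normal-unique : ∀ {s s'} → Normal s → Normal s' → profile N s ≡ profile N s' → s ≡ s'
  normal-unique {a , b , c} {a' , b' , c'} (a≡0 , half-b , hc) (a'≡0 , half-b' , hc') eq =
    cong₂ _,_ (toℕ-injective (trans a≡0 (sym a'≡0)))
              (cong₂ _,_ (toℕ-injective b≡b') (toℕ-injective c≡c'))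
    where
    open ≡-Reasoning
    b≡b' : toℕ b ≡ toℕ b'
    b≡b' = begin
      toℕ b           ≡⟨ arc-Half half-b ⟨
      arc (toℕ b)     ≡⟨ dist-from-0 b a≡0 ⟨
      dist N a b      ≡⟨ cong (proj₂ ∘ proj₂) eq ⟩
      dist N a' b'    ≡⟨ dist-from-0 b' a'≡0 ⟩
      arc (toℕ b')    ≡⟨ arc-Half half-b' ⟩
      toℕ b'          ∎
    arc-c≡arc-c' : arc (toℕ c) ≡ arc (toℕ c')
    arc-c≡arc-c' = begin
      arc (toℕ c)     ≡⟨ dist-from-0 c a≡0 ⟨
      dist N a c      ≡⟨ cong (proj₁ ∘ proj₂) eq ⟩
      dist N a' c'    ≡⟨ dist-from-0 c' a'≡0 ⟩
      arc (toℕ c')    ∎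
    dist-bc≡dist-bc' : arc ∣ toℕ b - toℕ c ∣ ≡ arc ∣ toℕ b - toℕ c' ∣
    dist-bc≡dist-bc' = begin
      arc ∣ toℕ b - toℕ c ∣    ≡⟨ dist≡arc∣-∣ b c ⟨
      dist N b c               ≡⟨ cong proj₁ eq ⟩
      dist N b' c'             ≡⟨ dist≡arc∣-∣ b' c' ⟩
      arc ∣ toℕ b' - toℕ c' ∣  ≡⟨ cong (λ k → arc ∣ k - toℕ c' ∣) b≡b' ⟨
      arc ∣ toℕ b - toℕ c' ∣   ∎
    c≡c' : toℕ c ≡ toℕ c'
    c≡c' = third-vertex-unique (toℕ<n c) (toℕ<n c') arc-c≡arc-c' hc
             (subst (λ e → Half (toℕ c') ⊎ OpenHalf e) (sym b≡b') hc') dist-bc≡dist-bc'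

  ≡profile⇒sameOrbit : ∀ t t' → profile N t ≡ profile N t' → SameOrbit N t t'
  ≡profile⇒sameOrbit t t' eq with normal-form t | normal-form t'
  ... | s , t~s , normal-s | s' , t'~s' , normal-s' =
    orbit-trans t~s (subst (λ u → SameOrbit N u t') (sym s≡s') (orbit-sym t'~s'))
    where
    s≡s' : s ≡ s'
    s≡s' = normal-unique normal-s normal-s'
             (trans (sym (sameOrbit⇒≡profile t~s)) (trans eq (sameOrbit⇒≡profile t'~s')))

-- The hypotheses on D only say that N ≥ 4; the argument works for every N ≥ 1.
corollary5p8 : (D N : ℕ) → 2 ≤ D → (N ≡ 2 * D) ⊎ (N ≡ 2 * D + 1) →
    .{{_ : NonZero N}} → (t t' : Triple N) →
    (SameOrbit N t t' → profile N t ≡ profile N t') ×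
    (profile N t ≡ profile N t' → SameOrbit N t t')
corollary5p8 D N _ _ t t' = Cycle.sameOrbit⇒≡profile N , Cycle.≡profile⇒sameOrbit N t t'
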